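{- Let $P$ be an Eulerian poset. Then the Eulerian Chow polynomial $\mathrm{H}_P(x)$ of $P$ equals the $h$-polynomial $h(\Delta(P),x)$ of the order complex $\Delta(P)$.
   Context: $P$ is a finite graded bounded poset with rank function $\rho$, rank $r=\rho(\widehat1)$, $\rho_{st}=\rho(t)-\rho(s)$. $P$ is Eulerian if its Möbius function satisfies $\mu_{st}=(-1)^{\rho_{st}}$ for all $s\le t$; then $\varepsilon_{st}(x)=(x-1)^{\rho_{st}}$ defines a kernel in the incidence algebra (maps $[s,t]\mapsto a_{st}(x)\in\mathbb{Z}[x]$, product $(ab)_{st}=\sum_{s\le w\le t}a_{sw}b_{wt}$). Let $\overline{\varepsilon}_{st}=(x-1)^{\rho_{st}-1}$ for $s<t$ and $\overline{\varepsilon}_{ss}=-1$; the Eulerian Chow function is $\mathrm{H}=-(\overline{\varepsilon})^{ -1}$ and $\mathrm{H}_P=\mathrm{H}_{\widehat0\widehat1}$. Here $\Delta(P)$ is the simplicial complex whose faces are the chains of the proper part $P\smallsetminus\{\widehat0,\widehat1\}$, so that the number $f_i$ of faces with $i$ elements is $\sum_{S\subseteq\{1,\dots,r-1\},|S|=i}$(number of chains with rank set $S$), with $f_0=1$. With $d=\dim\Delta(P)+1$, $f(\Delta,x)=\sum_{i=0}^d f_ix^{d-i}$ and $h(\Delta,x)=f(\Delta,x-1)$. -}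

module Defs where

open import Data.Nat as ℕ using (ℕ; zero; suc; _∸_; _⊔_)
open import Data.Integer as ℤ using (ℤ; +_; -_; -1ℤ; 0ℤ; 1ℤ)
open import Data.Fin using (Fin)
open import Data.Fin.Properties using (_≟_)
open import Data.List using (List; foldr; allFin)
open import Data.Product using (_×_; _,_)
open import Data.Sum using (_⊎_)
open import Relation.Binary.PropositionalEquality using (_≡_; _≢_)
open import Relation.Nullary using (Dec; yes; no)

-- Polynomials in ℤ[x], represented by their coefficient sequences
-- (p k = coefficient of x^k); equality of polynomials is coefficientwise.

Poly : Set
Poly = ℕ → ℤ

_≈ₚ_ : Poly → Poly → Set
p ≈ₚ q = ∀ k → p k ≡ q k

0ₚ : Poly
0ₚ _ = 0ℤ

constₚ : ℤ → Poly
constₚ c zero    = c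
constₚ c (suc _) = 0ℤ

1ₚ : Poly
1ₚ = constₚ 1ℤ

x-1 : Poly
x-1 zero          = -1ℤ
x-1 (suc zero)    = 1ℤ
x-1 (suc (suc _)) = 0ℤ

_+ₚ_ : Poly → Poly → Poly
(p +ₚ q) k = p k ℤ.+ q k

-ₚ_ : Poly → Poly
(-ₚ p) k = - p k

sumUpTo : ℕ → (ℕ → ℤ) → ℤ
sumUpTo zero    f = f zero
sumUpTo (suc k) f = sumUpTo k f ℤ.+ f (suc k)

_*ₚ_ : Poly → Poly → Poly
(p *ₚ q) k = sumUpTo k (λ i → p i ℤ.* q (k ∸ i))

_^ₚ_ : Poly → ℕ → Poly
p ^ₚ zero  = 1ₚ
p ^ₚ suc m = p *ₚ (p ^ₚ m)

_·ₚ_ : ℤ → Poly → Poly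
(c ·ₚ p) k = c ℤ.* p k

-- Finite graded bounded posets, on the carrier Fin n
-- (every finite poset is isomorphic to one on some Fin n).

record GradedBoundedPoset : Set₁ where
  field
    n       : ℕ
    _≤_     : Fin n → Fin n → Set
    _≤?_    : ∀ s t → Dec (s ≤ t)
    refl≤   : ∀ s → s ≤ s
    antisym : ∀ {s t} → s ≤ t → t ≤ s → s ≡ t
    trans≤  : ∀ {s t u} → s ≤ t → t ≤ u → s ≤ u
    𝟘 𝟙     : Fin n
    𝟘-min   : ∀ s → 𝟘 ≤ s
    𝟙-max   : ∀ s → s ≤ 𝟙
    ρ       : Fin n → ℕ
    ρ-𝟘     : ρ 𝟘 ≡ 0
    ρ-cover : ∀ {s t} → s ≤ t → s ≢ t →
              (∀ w → s ≤ w → w ≤ t → (w ≡ s) ⊎ (w ≡ t)) →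
              ρ t ≡ suc (ρ s)

module _ (P : GradedBoundedPoset) where
  open GradedBoundedPoset P

  rankP : ℕ
  rankP = ρ 𝟙

  ρ[_,_] : Fin n → Fin n → ℕ
  ρ[ s , t ] = ρ t ∸ ρ s

  private
    selℤ : ∀ {X Y : Set} → Dec X → Dec Y → ℤ → ℤ → ℤ
    selℤ (yes _) (yes _) v acc = v ℤ.+ acc
    selℤ _       _       _ acc = acc

    selₚ : ∀ {X Y : Set} → Dec X → Dec Y → Poly → Poly → Poly
    selₚ (yes _) (yes _) v acc = v +ₚ acc
    selₚ _       _       _ acc = acc

    selℕ : ∀ {X Y Z : Set} → Dec X → Dec Y → Dec Z → ℕ → ℕ → ℕ
    selℕ (yes _) (no _) (no _) v acc = v ℕ.+ acc
    selℕ _       _      _      _ acc = acc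

  Σₚ[_,_] : Fin n → Fin n → (Fin n → Poly) → Poly
  Σₚ[ s , t ] f = foldr (λ w acc → selₚ (s ≤? w) (w ≤? t) (f w) acc) 0ₚ (allFin n)

  Σℤ[_,_⟩ : Fin n → Fin n → (Fin n → ℤ) → ℤ
  Σℤ[ s , t ⟩ f = foldr (λ w acc → selℤ (s ≤? w) (w ≤? t) (g w) acc) 0ℤ (allFin n)
    where
      g : Fin n → ℤ
      g w with w ≟ t
      ... | yes _ = 0ℤ
      ... | no  _ = f w

  -- Computed by recursion with fuel; fuel n
  -- (the number of elements) is more than enough since any chain
  -- s < w₁ < … < t has at most n elements.
  mobiusF : ℕ → Fin n → Fin n → ℤ
  mobiusF fuel s t with s ≟ t | s ≤? t
  mobiusF fuel       s t | yes _ | _     = 1ℤ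
  mobiusF zero       s t | no _  | _     = 0ℤ
  mobiusF (suc fuel) s t | no _  | yes _ = - Σℤ[ s , t ⟩ (λ w → mobiusF fuel s w)
  mobiusF (suc fuel) s t | no _  | no _  = 0ℤ

  μ : Fin n → Fin n → ℤ
  μ = mobiusF n

  Eulerian : Set
  Eulerian = ∀ s t → s ≤ t → μ s t ≡ -1ℤ ℤ.^ ρ[ s , t ]

  -- Incidence algebra with coefficients in ℤ[x]: kernels are functions
  -- on pairs (s , t); only the values on intervals s ≤ t matter.
  Kernel : Set
  Kernel = Fin n → Fin n → Poly

  _⋆_ : Kernel → Kernel → Kernel
  (a ⋆ b) s t = Σₚ[ s , t ] (λ w → a s w *ₚ b w t)

  δ : Kernel
  δ s t with s ≟ t
  ... | yes _ = 1ₚ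
  ... | no  _ = 0ₚ

  _≈ₖ_ : Kernel → Kernel → Set
  a ≈ₖ b = ∀ s t → s ≤ t → a s t ≈ₚ b s t

  εbar : Kernel
  εbar s t with s ≟ t
  ... | yes _ = constₚ -1ℤ
  ... | no  _ = x-1 ^ₚ (ρ[ s , t ] ∸ 1)

  IsEulerianChowFunction : Kernel → Set
  IsEulerianChowFunction H =
    ((λ s t → -ₚ H s t) ⋆ εbar) ≈ₖ δ × (εbar ⋆ (λ s t → -ₚ H s t)) ≈ₖ δ

  -- Order complex Δ(P) of the proper part P ∖ {0̂, 1̂}.
  -- chainsAbove i s = number of chains s < c₁ < c₂ < … < cᵢ < 1̂
  -- with all cⱼ ∈ P ∖ {0̂, 1̂}.
  chainsAbove : ℕ → Fin n → ℕ
  chainsAbove zero    s = 1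
  chainsAbove (suc i) s =
    foldr (λ w acc → selℕ (s ≤? w) (w ≟ s) (w ≟ 𝟙)
                          (selℕ (𝟘 ≤? w) (w ≟ 𝟘) (w ≟ 𝟙) (chainsAbove i w) 0) acc)
          0 (allFin n)

  -- f_i = number of faces of Δ(P) with i elements (chains of the
  -- proper part with i elements); f_0 = 1 (the empty face).
  fvec : ℕ → ℕ
  fvec i = chainsAbove i 𝟘

  -- d = dim Δ(P) + 1 = the largest size of a face (faces have ≤ n elements)
  private
    nz : ℕ → ℕ → ℕ
    nz zero    i = 0
    nz (suc _) i = i

    maxFace : ℕ → ℕ
    maxFace zero    = nz (fvec zero) zero
    maxFace (suc i) = maxFace i ⊔ nz (fvec (suc i)) (suc i)

  dΔ : ℕ
  dΔ = maxFace n

  -- f(Δ,x) = Σ_{i=0}^{d} f_i x^{d-i}, h(Δ,x) = f(Δ,x-1)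
  --        = Σ_{i=0}^{d} f_i (x-1)^{d-i}
  private
    sumPoly : ℕ → (ℕ → Poly) → Poly
    sumPoly zero    g = g zero
    sumPoly (suc k) g = sumPoly k g +ₚ g (suc k)

  hΔ : Poly
  hΔ = sumPoly dΔ (λ i → (+ fvec i) ·ₚ (x-1 ^ₚ (dΔ ∸ i)))

-- Reading ε̄ ⋆ (−H) = δ on the intervals [s, 1̂] gives the recursion
--   H_{s1̂} = δ_{s1̂} + Σ_{s<w} (x−1)^{ρ_{sw}−1} H_{w1̂},
-- which determines H_{s1̂} by downward induction on s.  It is also solved by
--   h_s = Σ_i c_i(s) (x−1)^{ρ_{s1̂}−1−i},   c_i(s) = #{chains s < c₁ < ⋯ < c_i < 1̂},
-- because a chain of i+1 elements above s is a chain of i elements above its least element w,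
-- and (x−1)^{ρ_{sw}−1} (x−1)^{ρ_{w1̂}−1−i} = (x−1)^{ρ_{s1̂}−1−(i+1)}.  At s = 0̂ the c_i are the
-- face numbers f_i of Δ(P); the longest chains of the proper part have r−1 elements, so d = r−1
-- and h_{0̂} = h(Δ(P), x).

module Submission where

open import Defs
open import Algebra.Bundles using (AbelianGroup; Monoid)
import Algebra.Construct.Pointwise as Pointwise
import Algebra.Properties.CommutativeMonoid.Sum as Sum
import Data.Integer.Properties as ℤP
open import Algebra.Properties.CommutativeSemigroup ℤP.+-commutativeSemigroup
  using () renaming (interchange to +-interchange)
open import Algebra.Properties.CommutativeSemigroup ℤP.*-commutativeSemigroup
  using () renaming (x∙yz≈y∙xz to *-leftComm)
import Algebra.Properties.Group as GroupProperties
import Algebra.Properties.Monoid.Sum as MonoidSum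
open import Data.Bool using (if_then_else_)
open import Data.Empty using (⊥; ⊥-elim)
open import Data.Fin using (Fin; zero; suc; toℕ; punchIn)
open import Data.Fin.Induction using (po-wellFounded; po-noetherian)
open import Data.Fin.Properties
  using (_≟_; any?; injective⇒≤; punchInᵢ≢i; toℕ<n; toℕ-fromℕ; toℕ-inject₁; toℕ-injective)
open import Data.Integer as ℤ using (ℤ; +_; -_; -1ℤ; 0ℤ; 1ℤ)
open import Data.List using (foldr; allFin; tabulate)
open import Data.Nat as ℕ using (ℕ; zero; suc; _∸_; _⊔_)
import Data.Nat.Properties as ℕP
open import Data.Product using (∃; _×_; _,_; proj₁; proj₂)
open import Data.Sum using (_⊎_; inj₁; inj₂)
open import Function using (id; _∘_; flip)
open import Induction.WellFounded using (WellFounded; Acc; acc)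
open import Level using (0ℓ)
import Relation.Binary.Reasoning.Setoid as SetoidReasoning
open import Relation.Binary.Structures using (IsPartialOrder)
open import Relation.Binary.PropositionalEquality
  using (_≡_; _≢_; refl; sym; trans; cong; cong₂; isEquivalence; module ≡-Reasoning)
open import Relation.Nullary using (¬_; Dec; yes; no; does)
open import Relation.Nullary.Decidable using (_×-dec_; ¬?)

-- Polynomials

+ₚ-abelianGroup : AbelianGroup 0ℓ 0ℓ
+ₚ-abelianGroup = Pointwise.abelianGroup ℕ ℤP.+-0-abelianGroup

open AbelianGroup +ₚ-abelianGroup
  using (setoid; group; monoid; commutativeMonoid)
  renaming ( refl to ≈ₚ-refl; sym to ≈ₚ-sym; trans to ≈ₚ-trans; reflexive to ≈ₚ-reflexive
           ; ∙-cong to +ₚ-cong; ∙-congˡ to +ₚ-congˡ; ∙-congʳ to +ₚ-congʳ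
           ; identityˡ to +ₚ-identityˡ; identityʳ to +ₚ-identityʳ )
open GroupProperties group using (//-rightDividesˡ)
open Sum commutativeMonoid
  using ( sum; sum⁺-syntax; ∑-distrib-+; ∑-comm; sum-cong-≋; sum-replicate-zero
        ; sum-remove; sum-init-last )
module ℕΣ = Sum ℕP.+-0-commutativeMonoid
module ≈ₚ-Reasoning = SetoidReasoning setoid

sumUpTo-cong : ∀ k {f g : ℕ → ℤ} → (∀ i → f i ≡ g i) → sumUpTo k f ≡ sumUpTo k g
sumUpTo-cong zero    f≗g = f≗g zero
sumUpTo-cong (suc k) f≗g = cong₂ ℤ._+_ (sumUpTo-cong k f≗g) (f≗g (suc k))

sumUpTo-distrib-+ : ∀ k (f g : ℕ → ℤ) →
                    sumUpTo k (λ i → f i ℤ.+ g i) ≡ sumUpTo k f ℤ.+ sumUpTo k g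
sumUpTo-distrib-+ zero    f g = refl
sumUpTo-distrib-+ (suc k) f g =
  trans (cong (ℤ._+ (f (suc k) ℤ.+ g (suc k))) (sumUpTo-distrib-+ k f g))
        (+-interchange (sumUpTo k f) (sumUpTo k g) (f (suc k)) (g (suc k)))

*-distribˡ-sumUpTo : ∀ k c (f : ℕ → ℤ) → c ℤ.* sumUpTo k f ≡ sumUpTo k (λ i → c ℤ.* f i)
*-distribˡ-sumUpTo zero    c f = refl
*-distribˡ-sumUpTo (suc k) c f =
  trans (ℤP.*-distribˡ-+ c (sumUpTo k f) (f (suc k)))
        (cong (ℤ._+ c ℤ.* f (suc k)) (*-distribˡ-sumUpTo k c f))

sumUpTo-suc : ∀ k (f : ℕ → ℤ) → sumUpTo (suc k) f ≡ f 0 ℤ.+ sumUpTo k (f ∘ suc)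
sumUpTo-suc zero    f = refl
sumUpTo-suc (suc k) f = trans (cong (ℤ._+ f (suc (suc k))) (sumUpTo-suc k f))
                              (ℤP.+-assoc (f 0) (sumUpTo k (f ∘ suc)) (f (suc (suc k))))

sumUpTo-zero : ∀ k (f : ℕ → ℤ) → (∀ i → f i ≡ 0ℤ) → sumUpTo k f ≡ 0ℤ
sumUpTo-zero zero    f f≗0 = f≗0 zero
sumUpTo-zero (suc k) f f≗0 = cong₂ ℤ._+_ (sumUpTo-zero k f f≗0) (f≗0 (suc k))

sumUpTo-head : ∀ k (f : ℕ → ℤ) → (∀ i → f (suc i) ≡ 0ℤ) → sumUpTo k f ≡ f 0
sumUpTo-head zero    f _      = refl
sumUpTo-head (suc k) f tail≗0 =
  trans (sumUpTo-suc k f)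
        (trans (cong (λ z → f 0 ℤ.+ z) (sumUpTo-zero k (f ∘ suc) tail≗0)) (ℤP.+-identityʳ (f 0)))

*ₚ-congˡ : ∀ {p q} r → p ≈ₚ q → (p *ₚ r) ≈ₚ (q *ₚ r)
*ₚ-congˡ r p≈q k = sumUpTo-cong k (λ i → cong (ℤ._* r (k ∸ i)) (p≈q i))

*ₚ-congʳ : ∀ p {q r} → q ≈ₚ r → (p *ₚ q) ≈ₚ (p *ₚ r)
*ₚ-congʳ p q≈r k = sumUpTo-cong k (λ i → cong (p i ℤ.*_) (q≈r (k ∸ i)))

*ₚ-distribˡ-+ₚ : ∀ p q r → (p *ₚ (q +ₚ r)) ≈ₚ ((p *ₚ q) +ₚ (p *ₚ r))
*ₚ-distribˡ-+ₚ p q r k =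
  trans (sumUpTo-cong k (λ i → ℤP.*-distribˡ-+ (p i) (q (k ∸ i)) (r (k ∸ i))))
        (sumUpTo-distrib-+ k _ _)

*ₚ-distribʳ-+ₚ : ∀ p q r → ((p +ₚ q) *ₚ r) ≈ₚ ((p *ₚ r) +ₚ (q *ₚ r))
*ₚ-distribʳ-+ₚ p q r k =
  trans (sumUpTo-cong k (λ i → ℤP.*-distribʳ-+ (r (k ∸ i)) (p i) (q i)))
        (sumUpTo-distrib-+ k _ _)

*ₚ-zeroʳ : ∀ p → (p *ₚ 0ₚ) ≈ₚ 0ₚ
*ₚ-zeroʳ p k = sumUpTo-zero k _ (λ i → ℤP.*-zeroʳ (p i))

*ₚ-·ₚ : ∀ p c q → (p *ₚ (c ·ₚ q)) ≈ₚ (c ·ₚ (p *ₚ q))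
*ₚ-·ₚ p c q k =
  trans (sumUpTo-cong k (λ i → *-leftComm (p i) c (q (k ∸ i)))) (sym (*-distribˡ-sumUpTo k c _))

-ₚ-as-·ₚ : ∀ p → (-ₚ p) ≈ₚ (-1ℤ ·ₚ p)
-ₚ-as-·ₚ p k = sym (ℤP.-1*i≡-i (p k))

*ₚ-negˡ : ∀ p q → ((-ₚ p) *ₚ q) ≈ₚ (-ₚ (p *ₚ q))
*ₚ-negˡ p q k =
  trans (sumUpTo-cong k (λ i → trans (sym (ℤP.neg-distribˡ-* (p i) (q (k ∸ i))))
                                      (sym (ℤP.-1*i≡-i (p i ℤ.* q (k ∸ i))))))
        (trans (sym (*-distribˡ-sumUpTo k -1ℤ _)) (ℤP.-1*i≡-i _))

*ₚ-negʳ : ∀ p q → (p *ₚ (-ₚ q)) ≈ₚ (-ₚ (p *ₚ q))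
*ₚ-negʳ p q = ≈ₚ-trans (*ₚ-congʳ p (-ₚ-as-·ₚ q))
                       (≈ₚ-trans (*ₚ-·ₚ p -1ℤ q) (≈ₚ-sym (-ₚ-as-·ₚ (p *ₚ q))))

constₚ-*ₚ : ∀ c p → (constₚ c *ₚ p) ≈ₚ (c ·ₚ p)
constₚ-*ₚ c p k = sumUpTo-head k _ (λ i → ℤP.*-zeroˡ (p (k ∸ suc i)))

*ₚ-identityˡ : ∀ p → (1ₚ *ₚ p) ≈ₚ p
*ₚ-identityˡ p k = trans (constₚ-*ₚ 1ℤ p k) (ℤP.*-identityˡ (p k))

·ₚ-identityˡ : ∀ p → ((+ 1) ·ₚ p) ≈ₚ p
·ₚ-identityˡ p k = ℤP.*-identityˡ (p k)

·ₚ-zeroˡ : ∀ {c} q → c ≡ 0 → ((+ c) ·ₚ q) ≈ₚ 0ₚ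
·ₚ-zeroˡ q refl k = ℤP.*-zeroˡ (q k)

·ₚ-congʳ-nonzero : ∀ c {p q} → (c ≢ 0 → p ≈ₚ q) → ((+ c) ·ₚ p) ≈ₚ ((+ c) ·ₚ q)
·ₚ-congʳ-nonzero zero    {p} {q} _   k = trans (ℤP.*-zeroˡ (p k)) (sym (ℤP.*-zeroˡ (q k)))
·ₚ-congʳ-nonzero (suc c) p≈q k = cong (+ suc c ℤ.*_) (p≈q (λ ()) k)

x·ₚ_ : Poly → Poly
(x·ₚ p) zero    = 0ℤ
(x·ₚ p) (suc k) = p k

x·ₚ-*ₚ : ∀ p q → ((x·ₚ p) *ₚ q) ≈ₚ (x·ₚ (p *ₚ q))
x·ₚ-*ₚ p q zero    = ℤP.*-zeroˡ (q 0)
x·ₚ-*ₚ p q (suc k) =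
  trans (sumUpTo-suc k _)
        (trans (cong (ℤ._+ (p *ₚ q) k) (ℤP.*-zeroˡ (q (suc k)))) (ℤP.+-identityˡ _))

x-1-*ₚ : ∀ p → (x-1 *ₚ p) ≈ₚ ((x·ₚ p) +ₚ (-ₚ p))
x-1-*ₚ p zero    = trans (ℤP.-1*i≡-i (p 0)) (sym (ℤP.+-identityˡ _))
x-1-*ₚ p (suc k) =
  trans (sumUpTo-suc k _)
        (trans (cong₂ ℤ._+_ (ℤP.-1*i≡-i (p (suc k)))
                            (trans (sumUpTo-head k _ (λ i → ℤP.*-zeroˡ (p (k ∸ suc i))))
                                   (ℤP.*-identityˡ (p k))))
               (ℤP.+-comm (- p (suc k)) (p k)))

x-1-*ₚ-assoc : ∀ p q → ((x-1 *ₚ p) *ₚ q) ≈ₚ (x-1 *ₚ (p *ₚ q))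
x-1-*ₚ-assoc p q = begin
  (x-1 *ₚ p) *ₚ q                   ≈⟨ *ₚ-congˡ q (x-1-*ₚ p) ⟩
  ((x·ₚ p) +ₚ (-ₚ p)) *ₚ q          ≈⟨ *ₚ-distribʳ-+ₚ (x·ₚ p) (-ₚ p) q ⟩
  ((x·ₚ p) *ₚ q) +ₚ ((-ₚ p) *ₚ q)   ≈⟨ +ₚ-cong (x·ₚ-*ₚ p q) (*ₚ-negˡ p q) ⟩
  (x·ₚ (p *ₚ q)) +ₚ (-ₚ (p *ₚ q))   ≈⟨ x-1-*ₚ (p *ₚ q) ⟨
  x-1 *ₚ (p *ₚ q)                   ∎
  where open ≈ₚ-Reasoning

x-1^-+ : ∀ a b → ((x-1 ^ₚ a) *ₚ (x-1 ^ₚ b)) ≈ₚ (x-1 ^ₚ (a ℕ.+ b))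
x-1^-+ zero    b = *ₚ-identityˡ (x-1 ^ₚ b)
x-1^-+ (suc a) b = ≈ₚ-trans (x-1-*ₚ-assoc (x-1 ^ₚ a) (x-1 ^ₚ b)) (*ₚ-congʳ x-1 (x-1^-+ a b))

-- Finite sums

when : ∀ {A : Set} → Dec A → Poly → Poly
when a? p = if does a? then p else 0ₚ

when-cong : ∀ {A : Set} (a? : Dec A) {p q} → (A → p ≈ₚ q) → when a? p ≈ₚ when a? q
when-cong (yes a) p≈q = p≈q a
when-cong (no _)  _   = ≈ₚ-refl

when-¬ : ∀ {A : Set} (a? : Dec A) {p} → ¬ A → when a? p ≈ₚ 0ₚ
when-¬ (yes a) ¬a = ⊥-elim (¬a a)
when-¬ (no _)  _  = ≈ₚ-refl

when-neg : ∀ {A : Set} (a? : Dec A) p → when a? (-ₚ p) ≈ₚ (-ₚ when a? p)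
when-neg (yes _) p = ≈ₚ-refl
when-neg (no _)  p = ≈ₚ-refl

when-·ₚ : ∀ {A : Set} (a? : Dec A) c q →
          when a? ((+ c) ·ₚ q) ≈ₚ ((+ (if does a? then c else 0)) ·ₚ q)
when-·ₚ (yes _) c q   = ≈ₚ-refl
when-·ₚ (no _)  c q k = sym (ℤP.*-zeroˡ (q k))

when-⊎ : ∀ {A B C : Set} (a? : Dec A) (b? : Dec B) (c? : Dec C) p →
         (A → B ⊎ C) → (B → A) → (C → A) → (B → C → ⊥) →
         when a? p ≈ₚ (when b? p +ₚ when c? p)
when-⊎ (yes a) (yes b) (yes c) p _ _ _ b∩c = ⊥-elim (b∩c b c)
when-⊎ (yes a) (yes b) (no _)  p _ _ _ _   = ≈ₚ-sym (+ₚ-identityʳ p)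
when-⊎ (yes a) (no _)  (yes c) p _ _ _ _   = ≈ₚ-sym (+ₚ-identityˡ p)
when-⊎ (yes a) (no ¬b) (no ¬c) p a⇒b⊎c _ _ _ with a⇒b⊎c a
... | inj₁ b = ⊥-elim (¬b b)
... | inj₂ c = ⊥-elim (¬c c)
when-⊎ (no ¬a) (yes b) _       p _ b⇒a _ _ = ⊥-elim (¬a (b⇒a b))
when-⊎ (no ¬a) (no _)  (yes c) p _ _ c⇒a _ = ⊥-elim (¬a (c⇒a c))
when-⊎ (no _)  (no _)  (no _)  p _ _ _ _   = ≈ₚ-refl

∑-zero : ∀ {m} (f : Fin m → Poly) → (∀ i → f i ≈ₚ 0ₚ) → sum f ≈ₚ 0ₚ
∑-zero {m} f f≈0 = ≈ₚ-trans (sum-cong-≋ f≈0) (sum-replicate-zero m)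

∑-neg : ∀ {m} (f : Fin m → Poly) → sum (λ i → -ₚ f i) ≈ₚ (-ₚ sum f)
∑-neg {zero}  f   = ≈ₚ-refl
∑-neg {suc m} f k = trans (cong (λ z → - f zero k ℤ.+ z) (∑-neg (f ∘ suc) k))
                          (sym (ℤP.neg-distrib-+ (f zero k) (sum (f ∘ suc) k)))

∑-·ₚ : ∀ {m} (c : Fin m → ℕ) q → sum (λ i → (+ c i) ·ₚ q) ≈ₚ ((+ ℕΣ.sum c) ·ₚ q)
∑-·ₚ {zero}  c q k = sym (ℤP.*-zeroˡ (q k))
∑-·ₚ {suc m} c q k =
  trans (cong (λ z → + c zero ℤ.* q k ℤ.+ z) (∑-·ₚ (c ∘ suc) q k))
        (trans (sym (ℤP.*-distribʳ-+ (q k) (+ c zero) (+ ℕΣ.sum (c ∘ suc))))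
               (cong (ℤ._* q k) (sym (ℤP.pos-+ (c zero) (ℕΣ.sum (c ∘ suc))))))

*ₚ-distribˡ-∑ : ∀ p {m} (f : Fin m → Poly) → (p *ₚ sum f) ≈ₚ sum (λ i → p *ₚ f i)
*ₚ-distribˡ-∑ p {zero}  f = *ₚ-zeroʳ p
*ₚ-distribˡ-∑ p {suc m} f =
  ≈ₚ-trans (*ₚ-distribˡ-+ₚ p (f zero) (sum (f ∘ suc)))
           (+ₚ-congˡ {p *ₚ f zero} (*ₚ-distribˡ-∑ p (f ∘ suc)))

when-∑ : ∀ {A : Set} (a? : Dec A) {m} (f : Fin m → Poly) →
         when a? (sum f) ≈ₚ sum (λ i → when a? (f i))
when-∑ (yes _)     f = ≈ₚ-refl
when-∑ (no _) {m}  f = ≈ₚ-sym (∑-zero {m} _ (λ _ → ≈ₚ-refl))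

∑-when-≡ : ∀ {m} (s : Fin m) (f : Fin m → Poly) → sum (λ w → when (w ≟ s) (f w)) ≈ₚ f s
∑-when-≡ {suc m} s f = begin
  sum (λ w → when (w ≟ s) (f w))
    ≈⟨ sum-remove {i = s} (λ w → when (w ≟ s) (f w)) ⟩
  when (s ≟ s) (f s) +ₚ sum (λ j → when (punchIn s j ≟ s) (f (punchIn s j)))
    ≈⟨ +ₚ-cong (when-≡-refl (s ≟ s)) (∑-zero _ (λ j → when-¬ (punchIn s j ≟ s) (punchInᵢ≢i s j))) ⟩
  f s +ₚ 0ₚ
    ≈⟨ +ₚ-identityʳ (f s) ⟩
  f s
    ∎
  where
  open ≈ₚ-Reasoning
  when-≡-refl : (s≟s : Dec (s ≡ s)) → when s≟s (f s) ≈ₚ f s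
  when-≡-refl (yes _)  = ≈ₚ-refl
  when-≡-refl (no s≢s) = ⊥-elim (s≢s refl)

∑-when-split-off : ∀ {m} {A B : Fin m → Set} (a? : ∀ w → Dec (A w)) (b? : ∀ w → Dec (B w)) s f →
                   (∀ {w} → A w → w ≡ s ⊎ B w) → A s → (∀ {w} → B w → A w) → ¬ B s →
                   sum (λ w → when (a? w) (f w)) ≈ₚ (f s +ₚ sum (λ w → when (b? w) (f w)))
∑-when-split-off a? b? s f A⇒s⊎B As B⇒A ¬Bs = begin
  sum (λ w → when (a? w) (f w))
    ≈⟨ sum-cong-≋ (λ w → when-⊎ (a? w) (w ≟ s) (b? w) (f w) A⇒s⊎B (λ { refl → As }) B⇒A
                                 (λ { refl → ¬Bs })) ⟩
  sum (λ w → when (w ≟ s) (f w) +ₚ when (b? w) (f w))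
    ≈⟨ ∑-distrib-+ (λ w → when (w ≟ s) (f w)) (λ w → when (b? w) (f w)) ⟩
  sum (λ w → when (w ≟ s) (f w)) +ₚ sum (λ w → when (b? w) (f w))
    ≈⟨ +ₚ-congʳ {sum (λ w → when (b? w) (f w))} (∑-when-≡ s f) ⟩
  f s +ₚ sum (λ w → when (b? w) (f w))
    ∎
  where open ≈ₚ-Reasoning

∑≤ : ℕ → (ℕ → Poly) → Poly
∑≤ k g = ∑[ i ≤ k ] g (toℕ i)

∑≤-cong : ∀ k {f g : ℕ → Poly} → (∀ i → f i ≈ₚ g i) → ∑≤ k f ≈ₚ ∑≤ k g
∑≤-cong k f≈g = sum-cong-≋ {suc k} (f≈g ∘ toℕ)

∑≤-last : ∀ k g → ∑≤ (suc k) g ≈ₚ (∑≤ k g +ₚ g (suc k))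
∑≤-last k g =
  ≈ₚ-trans (sum-init-last {suc k} (g ∘ toℕ))
           (+ₚ-cong (sum-cong-≋ {suc k} (λ i → ≈ₚ-reflexive (cong g (toℕ-inject₁ i))))
                    (≈ₚ-reflexive (cong g (toℕ-fromℕ (suc k)))))

∑≤-shift : ∀ k g → g (suc k) ≈ₚ 0ₚ → ∑≤ k g ≈ₚ (g 0 +ₚ ∑≤ k (g ∘ suc))
∑≤-shift zero    g g1≈0   = +ₚ-congˡ {g 0} (≈ₚ-sym (≈ₚ-trans (+ₚ-identityʳ (g 1)) g1≈0))
∑≤-shift (suc k) g last≈0 =
  +ₚ-congˡ {g 0} (≈ₚ-sym (≈ₚ-trans (∑≤-last k (g ∘ suc))
                                   (≈ₚ-trans (+ₚ-congˡ {∑≤ k (g ∘ suc)} last≈0) (+ₚ-identityʳ _))))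

ℕΣ-zero : ∀ {m} (f : Fin m → ℕ) → (∀ i → f i ≡ 0) → ℕΣ.sum f ≡ 0
ℕΣ-zero {m} f f≡0 = trans (ℕΣ.sum-cong-≗ f≡0) (ℕΣ.sum-replicate-zero m)

ℕΣ-≥-term : ∀ {m} (f : Fin m → ℕ) i → f i ℕ.≤ ℕΣ.sum f
ℕΣ-≥-term {suc m} f i = ℕP.≤-trans (ℕP.m≤m+n (f i) _) (ℕP.≤-reflexive (sym (ℕΣ.sum-remove {i = i} f)))

∸1-+-∸1 : ∀ a b i → 0 ℕ.< a → i ℕ.< b → (a ∸ 1) ℕ.+ (b ∸ 1 ∸ i) ≡ (a ℕ.+ b) ∸ 1 ∸ suc i
∸1-+-∸1 (suc a) (suc b) i _ i<1+b = sym (ℕP.+-∸-assoc a i<1+b)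

module _ {c ℓ} (M : Monoid c ℓ) where
  open Monoid M using (Carrier; _≈_; _∙_; ε; ∙-congˡ) renaming (refl to ≈-refl; trans to ≈-trans)
  module M = MonoidSum M

  foldr-tabulate-≈-sum : ∀ {A : Set} {m} (h : Fin m → A) (g : A → Carrier → Carrier) (v : A → Carrier) →
                         (∀ a x → g a x ≈ v a ∙ x) → foldr g ε (tabulate h) ≈ M.sum (v ∘ h)
  foldr-tabulate-≈-sum {m = zero}  h g v g≈ = ≈-refl
  foldr-tabulate-≈-sum {m = suc m} h g v g≈ =
    ≈-trans (g≈ (h zero) _) (∙-congˡ (foldr-tabulate-≈-sum (h ∘ suc) g v g≈))

-- Defs keeps the summands of Σₚ[_,_] and chainsAbove and the helpers of dΔ and hΔ private.  Each
-- is named here by a metavariable that Agda solves from the refl proof of the equation after it;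
-- the withs turn the arguments into variables, so that these constraints are patterns.

open GradedBoundedPoset using () renaming (n to ∣_∣)

mutual
  Σₚ-step : (P : GradedBoundedPoset) (s t : Fin ∣ P ∣) → (Fin ∣ P ∣ → Poly) → Fin ∣ P ∣ → Poly → Poly
  Σₚ-step P = _

  Σₚ-unfold : ∀ P s t f → Σₚ[_,_] P s t f ≡ foldr (Σₚ-step P s t f) 0ₚ (allFin ∣ P ∣)
  Σₚ-unfold P s t f = refl

  chainsAbove-step : (P : GradedBoundedPoset) → ℕ → Fin ∣ P ∣ → Fin ∣ P ∣ → ℕ → ℕ
  chainsAbove-step P = _

  chainsAbove-unfold : ∀ P i s →
                       chainsAbove P (suc i) s ≡ foldr (chainsAbove-step P i s) 0 (allFin ∣ P ∣)
  chainsAbove-unfold P i s = refl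

  maxFaceSize : GradedBoundedPoset → ℕ → ℕ
  maxFaceSize P = _

  dΔ-unfold : ∀ P → dΔ P ≡ maxFaceSize P ∣ P ∣
  dΔ-unfold P with ∣ P ∣
  ... | _ = refl

  sizeIfNonempty : GradedBoundedPoset → ℕ → ℕ → ℕ
  sizeIfNonempty P = _

  maxFaceSize-suc : ∀ P k →
                    maxFaceSize P (suc k) ≡ maxFaceSize P k ⊔ sizeIfNonempty P (fvec P (suc k)) (suc k)
  maxFaceSize-suc P k with fvec P (suc k) | suc k
  ... | _ | _ = refl

  sumUpToₚ : GradedBoundedPoset → ℕ → (ℕ → Poly) → Poly
  sumUpToₚ P = _

  hΔ-unfold : ∀ P → hΔ P ≡ sumUpToₚ P (dΔ P) (λ i → (+ fvec P i) ·ₚ (x-1 ^ₚ (dΔ P ∸ i)))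
  hΔ-unfold P with dΔ P
  ... | d with (λ i → (+ fvec P i) ·ₚ (x-1 ^ₚ (d ∸ i)))
  ...   | _ = refl

module GradedPosetTheory (P : GradedBoundedPoset) where
  open GradedBoundedPoset P

  infix 4 _⊏_ _⊏?_

  _⊏_ : Fin n → Fin n → Set
  s ⊏ t = s ≤ t × s ≢ t

  _⊏?_ : ∀ s t → Dec (s ⊏ t)
  s ⊏? t = s ≤? t ×-dec ¬? (s ≟ t)

  ≤-isPartialOrder : IsPartialOrder _≡_ _≤_
  ≤-isPartialOrder = record
    { isPreorder = record
      { isEquivalence = isEquivalence
      ; reflexive     = λ { refl → refl≤ _ }
      ; trans         = trans≤
      }
    ; antisym = antisym
    }

  ⊏-wellFounded : WellFounded _⊏_
  ⊏-wellFounded = po-wellFounded ≤-isPartialOrder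

  ⊐-wellFounded : WellFounded (flip _⊏_)
  ⊐-wellFounded = po-noetherian ≤-isPartialOrder

  covered-or-split : ∀ {s t} → s ⊏ t → ρ t ≡ suc (ρ s) ⊎ ∃ λ u → s ⊏ u × u ⊏ t
  covered-or-split {s} {t} (s≤t , s≢t) with any? (λ u → s ⊏? u ×-dec u ⊏? t)
  ... | yes s⊏u⊏t = inj₂ s⊏u⊏t
  ... | no ∄u     = inj₁ (ρ-cover s≤t s≢t only-endpoints)
    where
    only-endpoints : ∀ w → s ≤ w → w ≤ t → w ≡ s ⊎ w ≡ t
    only-endpoints w s≤w w≤t with w ≟ s | w ≟ t
    ... | yes w≡s | _       = inj₁ w≡s
    ... | no _    | yes w≡t = inj₂ w≡t
    ... | no w≢s  | no w≢t  = ⊥-elim (∄u (w , (s≤w , w≢s ∘ sym) , (w≤t , w≢t)))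

  cover-below : ∀ {s t} → s ⊏ t → ∃ λ w → s ⊏ w × w ≤ t × ρ w ≡ suc (ρ s)
  cover-below {s} {t} = go (⊏-wellFounded t)
    where
    go : ∀ {t} → Acc _⊏_ t → s ⊏ t → ∃ λ w → s ⊏ w × w ≤ t × ρ w ≡ suc (ρ s)
    go {t} (acc rec) s⊏t with covered-or-split s⊏t
    ... | inj₁ t-covers-s = t , s⊏t , refl≤ t , t-covers-s
    ... | inj₂ (u , s⊏u , u⊏t) with go (rec u⊏t) s⊏u
    ...   | w , s⊏w , w≤u , w-covers-s = w , s⊏w , trans≤ w≤u (proj₁ u⊏t) , w-covers-s

  ρ-mono-⊏ : ∀ {s t} → s ⊏ t → ρ s ℕ.< ρ t
  ρ-mono-⊏ {s} = go (⊐-wellFounded s)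
    where
    go : ∀ {s t} → Acc (flip _⊏_) s → s ⊏ t → ρ s ℕ.< ρ t
    go {s} {t} (acc rec) s⊏t with cover-below s⊏t
    ... | w , s⊏w , w≤t , ρw≡1+ρs with w ≟ t
    ...   | yes refl = ℕP.≤-reflexive (sym ρw≡1+ρs)
    ...   | no w≢t   = ℕP.<-trans (ℕP.≤-reflexive (sym ρw≡1+ρs)) (go (rec s⊏w) (w≤t , w≢t))

  ρ-mono : ∀ {s t} → s ≤ t → ρ s ℕ.≤ ρ t
  ρ-mono {s} {t} s≤t with s ≟ t
  ... | yes refl = ℕP.≤-refl
  ... | no s≢t   = ℕP.<⇒≤ (ρ-mono-⊏ (s≤t , s≢t))

  r : ℕ
  r = ρ 𝟙

  element-of-rank : ∀ k → k ℕ.≤ r → ∃ λ w → ρ w ≡ k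
  element-of-rank zero    _   = 𝟘 , ρ-𝟘
  element-of-rank (suc k) k<r with element-of-rank k (ℕP.<⇒≤ k<r)
  ... | w , ρw≡k with cover-below (𝟙-max w , λ { refl → ℕP.<-irrefl (sym ρw≡k) k<r })
  ...   | v , _ , _ , ρv≡1+ρw = v , trans ρv≡1+ρw (cong suc ρw≡k)

  rank<size : r ℕ.< n
  rank<size = injective⇒≤ {f = proj₁ ∘ of-rank} of-rank-injective
    where
    of-rank : (i : Fin (suc r)) → ∃ λ w → ρ w ≡ toℕ i
    of-rank i = element-of-rank (toℕ i) (ℕ.s≤s⁻¹ (toℕ<n i))
    of-rank-injective : ∀ {i j} → proj₁ (of-rank i) ≡ proj₁ (of-rank j) → i ≡ j
    of-rank-injective {i} {j} eq =
      toℕ-injective (trans (sym (proj₂ (of-rank i))) (trans (cong ρ eq) (proj₂ (of-rank j))))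

  corank : Fin n → ℕ
  corank s = ρ 𝟙 ∸ ρ s

  corank-𝟘 : corank 𝟘 ≡ r
  corank-𝟘 = cong (ρ 𝟙 ∸_) ρ-𝟘

  corank-𝟙 : corank 𝟙 ≡ 0
  corank-𝟙 = ℕP.n∸n≡0 (ρ 𝟙)

  corank-≤ : ∀ s → corank s ℕ.≤ r
  corank-≤ s = ℕP.m∸n≤m (ρ 𝟙) (ρ s)

  corank-pos : ∀ {s} → s ≢ 𝟙 → 0 ℕ.< corank s
  corank-pos {s} s≢𝟙 = ℕP.m<n⇒0<n∸m (ρ-mono-⊏ (𝟙-max s , s≢𝟙))

  corank-suc⇒≢𝟙 : ∀ {s k} → corank s ≡ suc k → s ≢ 𝟙
  corank-suc⇒≢𝟙 corank≡1+k refl = ℕP.0≢1+n (trans (sym corank-𝟙) corank≡1+k)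

  corank-mono-⊏ : ∀ {s w} → s ⊏ w → corank w ℕ.< corank s
  corank-mono-⊏ {s} {w} s⊏w = ℕP.∸-monoʳ-< (ρ-mono-⊏ s⊏w) (ρ-mono (𝟙-max w))

  ρ-interval-+-corank : ∀ {s w} → s ≤ w → (ρ w ∸ ρ s) ℕ.+ corank w ≡ corank s
  ρ-interval-+-corank {s} {w} s≤w = begin
    (ρ w ∸ ρ s) ℕ.+ corank w       ≡⟨ ℕP.+-comm (ρ w ∸ ρ s) (corank w) ⟩
    corank w ℕ.+ (ρ w ∸ ρ s)       ≡⟨ ℕP.+-∸-assoc (corank w) (ρ-mono s≤w) ⟨
    (corank w ℕ.+ ρ w) ∸ ρ s       ≡⟨ cong (_∸ ρ s) (ℕP.m∸n+n≡m (ρ-mono (𝟙-max w))) ⟩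
    ρ 𝟙 ∸ ρ s                      ∎
    where open ≡-Reasoning

  δ-refl : ∀ s → δ P s s ≈ₚ 1ₚ
  δ-refl s with s ≟ s
  ... | yes _  = ≈ₚ-refl
  ... | no s≢s = ⊥-elim (s≢s refl)

  δ-≢ : ∀ {s t} → s ≢ t → δ P s t ≈ₚ 0ₚ
  δ-≢ {s} {t} s≢t with s ≟ t
  ... | yes s≡t = ⊥-elim (s≢t s≡t)
  ... | no _    = ≈ₚ-refl

  εbar-refl : ∀ s → εbar P s s ≈ₚ constₚ -1ℤ
  εbar-refl s with s ≟ s
  ... | yes _  = ≈ₚ-refl
  ... | no s≢s = ⊥-elim (s≢s refl)

  εbar-⊏ : ∀ {s t} → s ⊏ t → εbar P s t ≈ₚ (x-1 ^ₚ (ρ t ∸ ρ s ∸ 1))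
  εbar-⊏ {s} {t} (_ , s≢t) with s ≟ t
  ... | yes s≡t = ⊥-elim (s≢t s≡t)
  ... | no _    = ≈ₚ-refl

  -- Chain counts and the dimension of Δ(P)

  Interior : Fin n → Fin n → Set
  Interior s w = s ⊏ w × w ≢ 𝟙

  interior? : ∀ s w → Dec (Interior s w)
  interior? s w = s ⊏? w ×-dec ¬? (w ≟ 𝟙)

  chainsAbove-suc : ∀ i s → chainsAbove P (suc i) s
                          ≡ ℕΣ.sum (λ w → if does (interior? s w) then chainsAbove P i w else 0)
  chainsAbove-suc i s =
    trans (chainsAbove-unfold P i s)
          (foldr-tabulate-≈-sum ℕP.+-0-monoid id (chainsAbove-step P i s) _
                                (λ w total → step w total (interior? s w)))
    where
    step : ∀ w total (int? : Dec (Interior s w)) →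
           chainsAbove-step P i s w total ≡ (if does int? then chainsAbove P i w else 0) ℕ.+ total
    step w total int? with int? | s ≤? w | w ≟ s | w ≟ 𝟙 | 𝟘 ≤? w | w ≟ 𝟘
    ... | yes _ | yes _ | no _ | no _ | yes _ | no _ = cong (ℕ._+ total) (ℕP.+-identityʳ _)
    ... | no ¬int | yes s≤w | no w≢s | no w≢𝟙 | _ | _ = ⊥-elim (¬int ((s≤w , w≢s ∘ sym) , w≢𝟙))
    ... | yes _ | _ | _ | _ | no 𝟘≰w | _ = ⊥-elim (𝟘≰w (𝟘-min w))
    ... | yes ((s≤w , s≢w) , _) | _ | _ | _ | _ | yes refl = ⊥-elim (s≢w (antisym s≤w (𝟘-min s)))
    ... | yes ((s≤w , _) , _) | no s≰w | _ | _ | _ | _ = ⊥-elim (s≰w s≤w)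
    ... | yes ((_ , s≢w) , _) | _ | yes w≡s | _ | _ | _ = ⊥-elim (s≢w (sym w≡s))
    ... | yes (_ , w≢𝟙) | _ | _ | yes w≡𝟙 | _ | _ = ⊥-elim (w≢𝟙 w≡𝟙)
    ... | no _ | no _ | _ | _ | _ | _ = refl
    ... | no _ | yes _ | yes _ | _ | _ | _ = refl
    ... | no _ | yes _ | no _ | yes _ | _ | _ = refl

  chainsAbove-vanish : ∀ i s → corank s ℕ.≤ suc i → chainsAbove P (suc i) s ≡ 0
  chainsAbove-vanish-below : ∀ i w → w ≢ 𝟙 → corank w ℕ.≤ i → chainsAbove P i w ≡ 0

  chainsAbove-vanish i s corank≤1+i =
    trans (chainsAbove-suc i s) (ℕΣ-zero _ (λ w → term (interior? s w)))
    where
    term : ∀ {w} (int? : Dec (Interior s w)) → (if does int? then chainsAbove P i w else 0) ≡ 0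
    term (yes (s⊏w , w≢𝟙)) =
      chainsAbove-vanish-below i _ w≢𝟙 (ℕ.s≤s⁻¹ (ℕP.<-≤-trans (corank-mono-⊏ s⊏w) corank≤1+i))
    term (no _) = refl

  chainsAbove-vanish-below zero    w w≢𝟙 corank≤0 = ⊥-elim (ℕP.<⇒≱ (corank-pos w≢𝟙) corank≤0)
  chainsAbove-vanish-below (suc i) w _   corank≤  = chainsAbove-vanish i w corank≤

  chainsAbove-pos : ∀ k s → corank s ≡ suc k → 0 ℕ.< chainsAbove P k s
  chainsAbove-pos zero    s _ = ℕ.s≤s ℕ.z≤n
  chainsAbove-pos (suc k) s corank≡2+k with cover-below (𝟙-max s , corank-suc⇒≢𝟙 corank≡2+k)
  ... | w , s⊏w , _ , ρw≡1+ρs = begin-strict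
    0                                                      <⟨ chainsAbove-pos k w corank≡1+k ⟩
    chainsAbove P k w                                      ≡⟨ term (interior? s w) ⟨
    (if does (interior? s w) then chainsAbove P k w else 0) ≤⟨ ℕΣ-≥-term _ w ⟩
    ℕΣ.sum (λ v → if does (interior? s v) then chainsAbove P k v else 0)
                                                           ≡⟨ chainsAbove-suc k s ⟨
    chainsAbove P (suc k) s                                ∎
    where
    open ℕP.≤-Reasoning
    corank≡1+k : corank w ≡ suc k
    corank≡1+k = trans (cong (ρ 𝟙 ∸_) ρw≡1+ρs)
                       (trans (sym (ℕP.pred[m∸n]≡m∸[1+n] (ρ 𝟙) (ρ s))) (cong ℕ.pred corank≡2+k))
    term : (int? : Dec (Interior s w)) →
           (if does int? then chainsAbove P k w else 0) ≡ chainsAbove P k w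
    term (yes _)   = refl
    term (no ¬int) = ⊥-elim (¬int (s⊏w , corank-suc⇒≢𝟙 corank≡1+k))

  d : ℕ
  d = r ∸ 1

  r≤1+d : r ℕ.≤ suc d
  r≤1+d = ℕP.m≤n+m∸n r 1

  fvec-vanish : ∀ i → d ℕ.≤ i → fvec P (suc i) ≡ 0
  fvec-vanish i d≤i =
    chainsAbove-vanish i 𝟘 (ℕP.≤-trans (ℕP.≤-reflexive corank-𝟘) (ℕP.≤-trans r≤1+d (ℕ.s≤s d≤i)))

  fvec-d≢0 : fvec P d ≢ 0
  fvec-d≢0 with r in r≡
  ... | zero  = λ ()
  ... | suc k = ℕP.>⇒≢ (chainsAbove-pos k 𝟘 (trans corank-𝟘 r≡))

  sizeIfNonempty-≤ : ∀ c j → sizeIfNonempty P c j ℕ.≤ j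
  sizeIfNonempty-≤ zero    j = ℕ.z≤n
  sizeIfNonempty-≤ (suc c) j = ℕP.≤-refl

  sizeIfNonempty-≢0 : ∀ {c} j → c ≢ 0 → sizeIfNonempty P c j ≡ j
  sizeIfNonempty-≢0 {zero}  j c≢0 = ⊥-elim (c≢0 refl)
  sizeIfNonempty-≢0 {suc c} j _   = refl

  maxFaceSize-≤ : ∀ k → maxFaceSize P k ℕ.≤ k
  maxFaceSize-≤ zero    = ℕ.z≤n
  maxFaceSize-≤ (suc k) =
    ℕP.≤-trans (ℕP.≤-reflexive (maxFaceSize-suc P k))
               (ℕP.⊔-lub (ℕP.m≤n⇒m≤1+n (maxFaceSize-≤ k)) (sizeIfNonempty-≤ (fvec P (suc k)) (suc k)))

  maxFaceSize-nonempty : ∀ k → fvec P k ≢ 0 → maxFaceSize P k ≡ k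
  maxFaceSize-nonempty zero    _    = refl
  maxFaceSize-nonempty (suc k) fk≢0 = begin
    maxFaceSize P (suc k)
      ≡⟨ maxFaceSize-suc P k ⟩
    maxFaceSize P k ⊔ sizeIfNonempty P (fvec P (suc k)) (suc k)
      ≡⟨ cong (maxFaceSize P k ⊔_) (sizeIfNonempty-≢0 (suc k) fk≢0) ⟩
    maxFaceSize P k ⊔ suc k
      ≡⟨ ℕP.m≤n⇒m⊔n≡n (ℕP.m≤n⇒m≤1+n (maxFaceSize-≤ k)) ⟩
    suc k
      ∎
    where open ≡-Reasoning

  maxFaceSize-beyond-d : ∀ j → maxFaceSize P (d ℕ.+ j) ≡ d
  maxFaceSize-beyond-d zero    =
    trans (cong (maxFaceSize P) (ℕP.+-identityʳ d)) (maxFaceSize-nonempty d fvec-d≢0)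
  maxFaceSize-beyond-d (suc j) = begin
    maxFaceSize P (d ℕ.+ suc j)
      ≡⟨ cong (maxFaceSize P) (ℕP.+-suc d j) ⟩
    maxFaceSize P (suc (d ℕ.+ j))
      ≡⟨ maxFaceSize-suc P (d ℕ.+ j) ⟩
    maxFaceSize P (d ℕ.+ j) ⊔ sizeIfNonempty P (fvec P (suc (d ℕ.+ j))) (suc (d ℕ.+ j))
      ≡⟨ cong₂ _⊔_ (maxFaceSize-beyond-d j)
                   (cong (λ c → sizeIfNonempty P c (suc (d ℕ.+ j)))
                         (fvec-vanish (d ℕ.+ j) (ℕP.m≤m+n d j))) ⟩
    d ⊔ 0
      ≡⟨ ℕP.⊔-identityʳ d ⟩
    d
      ∎
    where open ≡-Reasoning

  dΔ≡d : dΔ P ≡ d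
  dΔ≡d with ℕP.m≤n⇒∃[o]m+o≡n (ℕP.≤-trans (ℕP.m∸n≤m r 1) (ℕP.<⇒≤ rank<size))
  ... | j , d+j≡n =
    trans (dΔ-unfold P) (trans (cong (maxFaceSize P) (sym d+j≡n)) (maxFaceSize-beyond-d j))

  -- The Chow recursion

  chowTerm : (Fin n → Poly) → Fin n → Fin n → Poly
  chowTerm F s w = (x-1 ^ₚ (ρ w ∸ ρ s ∸ 1)) *ₚ F w

  ChowRecursion : (Fin n → Poly) → Set
  ChowRecursion F = ∀ s → F s ≈ₚ (δ P s 𝟙 +ₚ sum (λ w → when (s ⊏? w) (chowTerm F s w)))

  chowRecursion-unique : ∀ {F G} → ChowRecursion F → ChowRecursion G → ∀ s → F s ≈ₚ G s
  chowRecursion-unique {F} {G} F-rec G-rec s = go (⊐-wellFounded s)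
    where
    open ≈ₚ-Reasoning
    go : ∀ {s} → Acc (flip _⊏_) s → F s ≈ₚ G s
    go {s} (acc rec) = begin
      F s                                                     ≈⟨ F-rec s ⟩
      δ P s 𝟙 +ₚ sum (λ w → when (s ⊏? w) (chowTerm F s w))
        ≈⟨ +ₚ-congˡ {δ P s 𝟙} (sum-cong-≋ (λ w → when-cong (s ⊏? w) (λ s⊏w →
             *ₚ-congʳ (x-1 ^ₚ (ρ w ∸ ρ s ∸ 1)) (go (rec s⊏w))))) ⟩
      δ P s 𝟙 +ₚ sum (λ w → when (s ⊏? w) (chowTerm G s w))  ≈⟨ G-rec s ⟨
      G s                                                     ∎

  Σₚ-split-bottom : ∀ s f → Σₚ[_,_] P s 𝟙 f ≈ₚ (f s +ₚ sum (λ w → when (s ⊏? w) (f w)))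
  Σₚ-split-bottom s f = begin
    Σₚ[_,_] P s 𝟙 f
      ≡⟨ Σₚ-unfold P s 𝟙 f ⟩
    foldr (Σₚ-step P s 𝟙 f) 0ₚ (allFin n)
      ≈⟨ foldr-tabulate-≈-sum monoid id (Σₚ-step P s 𝟙 f) _ step ⟩
    sum (λ w → when (s ≤? w) (f w))
      ≈⟨ ∑-when-split-off (s ≤?_) (s ⊏?_) s f equal-or-above (refl≤ s) proj₁ (λ (_ , s≢s) → s≢s refl) ⟩
    f s +ₚ sum (λ w → when (s ⊏? w) (f w))
      ∎
    where
    open ≈ₚ-Reasoning
    step : ∀ w rest → Σₚ-step P s 𝟙 f w rest ≈ₚ (when (s ≤? w) (f w) +ₚ rest)
    step w rest with s ≤? w | w ≤? 𝟙
    ... | yes _ | yes _  = ≈ₚ-refl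
    ... | yes _ | no w≰𝟙 = ⊥-elim (w≰𝟙 (𝟙-max w))
    ... | no _  | _      = ≈ₚ-sym (+ₚ-identityˡ rest)
    equal-or-above : ∀ {w} → s ≤ w → w ≡ s ⊎ s ⊏ w
    equal-or-above {w} s≤w with w ≟ s
    ... | yes w≡s = inj₁ w≡s
    ... | no w≢s  = inj₂ (s≤w , w≢s ∘ sym)

  chowFunction-recursion : (H : Kernel P) → _≈ₖ_ P (_⋆_ P (εbar P) (λ s t → -ₚ H s t)) (δ P) →
                           ChowRecursion (λ s → H s 𝟙)
  chowFunction-recursion H εbar⋆[-H]≈δ s = begin
    H s 𝟙                     ≈⟨ //-rightDividesˡ S (H s 𝟙) ⟨
    (H s 𝟙 +ₚ (-ₚ S)) +ₚ S    ≈⟨ +ₚ-congʳ {S} H-S≈δ ⟩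
    δ P s 𝟙 +ₚ S              ∎
    where
    open ≈ₚ-Reasoning
    H·𝟙 : Fin n → Poly
    H·𝟙 w = H w 𝟙
    S : Poly
    S = sum (λ w → when (s ⊏? w) (chowTerm H·𝟙 s w))
    diagonal : (εbar P s s *ₚ (-ₚ H s 𝟙)) ≈ₚ H s 𝟙
    diagonal k = trans (*ₚ-congˡ (-ₚ H s 𝟙) (εbar-refl s) k)
                       (trans (constₚ-*ₚ -1ℤ (-ₚ H s 𝟙) k) (trans (ℤP.-1*i≡-i _) (ℤP.neg-involutive _)))
    above : sum (λ w → when (s ⊏? w) (εbar P s w *ₚ (-ₚ H w 𝟙))) ≈ₚ (-ₚ S)
    above = ≈ₚ-trans (sum-cong-≋ (λ w →
              ≈ₚ-trans (when-cong (s ⊏? w) (λ s⊏w →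
                          ≈ₚ-trans (*ₚ-congˡ (-ₚ H w 𝟙) (εbar-⊏ s⊏w))
                                   (*ₚ-negʳ (x-1 ^ₚ (ρ w ∸ ρ s ∸ 1)) (H w 𝟙))))
                       (when-neg (s ⊏? w) (chowTerm H·𝟙 s w))))
            (∑-neg (λ w → when (s ⊏? w) (chowTerm H·𝟙 s w)))
    H-S≈δ : (H s 𝟙 +ₚ (-ₚ S)) ≈ₚ δ P s 𝟙
    H-S≈δ = begin
      H s 𝟙 +ₚ (-ₚ S)
        ≈⟨ +ₚ-cong diagonal above ⟨
      (εbar P s s *ₚ (-ₚ H s 𝟙)) +ₚ sum (λ w → when (s ⊏? w) (εbar P s w *ₚ (-ₚ H w 𝟙)))
        ≈⟨ Σₚ-split-bottom s (λ w → εbar P s w *ₚ (-ₚ H w 𝟙)) ⟨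
      Σₚ[_,_] P s 𝟙 (λ w → εbar P s w *ₚ (-ₚ H w 𝟙))
        ≈⟨ εbar⋆[-H]≈δ s 𝟙 (𝟙-max s) ⟩
      δ P s 𝟙
        ∎

  chainTerm : Fin n → ℕ → Poly
  chainTerm s i = (+ chainsAbove P i s) ·ₚ (x-1 ^ₚ (corank s ∸ 1 ∸ i))

  -- The h-polynomial of the order complex of the open interval (s, 𝟙); summing up to d rather
  -- than up to its dimension only adds zero terms.
  hInterval : Fin n → Poly
  hInterval s = ∑≤ d (chainTerm s)

  hInterval-unfold : ∀ s → hInterval s ≈ₚ ((x-1 ^ₚ (corank s ∸ 1)) +ₚ ∑≤ d (chainTerm s ∘ suc))
  hInterval-unfold s =
    ≈ₚ-trans (∑≤-shift d (chainTerm s) (·ₚ-zeroˡ _ top-vanishes))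
             (+ₚ-congʳ {∑≤ d (chainTerm s ∘ suc)} (·ₚ-identityˡ (x-1 ^ₚ (corank s ∸ 1))))
    where
    top-vanishes : chainsAbove P (suc d) s ≡ 0
    top-vanishes = chainsAbove-vanish d s (ℕP.≤-trans (corank-≤ s) r≤1+d)

  hInterval-𝟙 : hInterval 𝟙 ≈ₚ 1ₚ
  hInterval-𝟙 = begin
    hInterval 𝟙
      ≈⟨ hInterval-unfold 𝟙 ⟩
    (x-1 ^ₚ (corank 𝟙 ∸ 1)) +ₚ ∑≤ d (chainTerm 𝟙 ∘ suc)
      ≈⟨ +ₚ-cong (≈ₚ-reflexive (cong (λ c → x-1 ^ₚ (c ∸ 1)) corank-𝟙)) tail≈0 ⟩
    1ₚ +ₚ 0ₚ
      ≈⟨ +ₚ-identityʳ 1ₚ ⟩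
    1ₚ
      ∎
    where
    open ≈ₚ-Reasoning
    tail≈0 : ∑≤ d (chainTerm 𝟙 ∘ suc) ≈ₚ 0ₚ
    tail≈0 = ∑-zero {suc d} _ (λ i →
      ·ₚ-zeroˡ (x-1 ^ₚ (corank 𝟙 ∸ 1 ∸ suc (toℕ i)))
               (chainsAbove-vanish (toℕ i) 𝟙 (ℕP.≤-trans (ℕP.≤-reflexive corank-𝟙) ℕ.z≤n)))

  chainsAbove-suc-·ₚ : ∀ s i q → sum (λ w → when (interior? s w) ((+ chainsAbove P i w) ·ₚ q))
                                 ≈ₚ ((+ chainsAbove P (suc i) s) ·ₚ q)
  chainsAbove-suc-·ₚ s i q = begin
    sum (λ w → when (interior? s w) ((+ chainsAbove P i w) ·ₚ q))
      ≈⟨ sum-cong-≋ (λ w → when-·ₚ (interior? s w) (chainsAbove P i w) q) ⟩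
    sum (λ w → (+ (if does (interior? s w) then chainsAbove P i w else 0)) ·ₚ q)
      ≈⟨ ∑-·ₚ (λ w → if does (interior? s w) then chainsAbove P i w else 0) q ⟩
    (+ ℕΣ.sum (λ w → if does (interior? s w) then chainsAbove P i w else 0)) ·ₚ q
      ≡⟨ cong (λ c → (+ c) ·ₚ q) (chainsAbove-suc i s) ⟨
    (+ chainsAbove P (suc i) s) ·ₚ q
      ∎
    where open ≈ₚ-Reasoning

  chowTerm-chainTerm : ∀ {s w} → Interior s w → ∀ i →
                       ((x-1 ^ₚ (ρ w ∸ ρ s ∸ 1)) *ₚ chainTerm w i)
                       ≈ₚ ((+ chainsAbove P i w) ·ₚ (x-1 ^ₚ (corank s ∸ 1 ∸ suc i)))
  chowTerm-chainTerm {s} {w} (s⊏w , w≢𝟙) i =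
    ≈ₚ-trans (*ₚ-·ₚ (x-1 ^ₚ (ρ w ∸ ρ s ∸ 1)) (+ chainsAbove P i w) (x-1 ^ₚ (corank w ∸ 1 ∸ i)))
             (·ₚ-congʳ-nonzero (chainsAbove P i w) (λ chains≢0 →
               ≈ₚ-trans (x-1^-+ (ρ w ∸ ρ s ∸ 1) (corank w ∸ 1 ∸ i))
                        (≈ₚ-reflexive (cong (x-1 ^ₚ_) (exponents chains≢0)))))
    where
    exponents : chainsAbove P i w ≢ 0 →
                (ρ w ∸ ρ s ∸ 1) ℕ.+ (corank w ∸ 1 ∸ i) ≡ corank s ∸ 1 ∸ suc i
    exponents chains≢0 =
      trans (∸1-+-∸1 (ρ w ∸ ρ s) (corank w) i (ℕP.m<n⇒0<n∸m (ρ-mono-⊏ s⊏w)) i<corank)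
            (cong (λ c → c ∸ 1 ∸ suc i) (ρ-interval-+-corank (proj₁ s⊏w)))
      where
      i<corank : i ℕ.< corank w
      i<corank = ℕP.≰⇒> (chains≢0 ∘ chainsAbove-vanish-below i w w≢𝟙)

  ∑-interior-chowTerm : ∀ s → sum (λ w → when (interior? s w) (chowTerm hInterval s w))
                              ≈ₚ ∑≤ d (chainTerm s ∘ suc)
  ∑-interior-chowTerm s = begin
    sum (λ w → when (interior? s w) (chowTerm hInterval s w))
      ≈⟨ sum-cong-≋ (λ w → when-cong (interior? s w) (λ int →
           ≈ₚ-trans (*ₚ-distribˡ-∑ (x-1 ^ₚ (ρ w ∸ ρ s ∸ 1)) {suc d} (chainTerm w ∘ toℕ))
                    (∑≤-cong d (chowTerm-chainTerm int)))) ⟩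
    sum (λ w → when (interior? s w) (∑≤ d (lowered w)))
      ≈⟨ sum-cong-≋ (λ w → when-∑ (interior? s w) {suc d} (lowered w ∘ toℕ)) ⟩
    sum (λ w → ∑≤ d (λ i → when (interior? s w) (lowered w i)))
      ≈⟨ ∑-comm {n} {suc d} (λ w i → when (interior? s w) (lowered w (toℕ i))) ⟩
    ∑≤ d (λ i → sum (λ w → when (interior? s w) (lowered w i)))
      ≈⟨ ∑≤-cong d (λ i → chainsAbove-suc-·ₚ s i (x-1 ^ₚ (corank s ∸ 1 ∸ suc i))) ⟩
    ∑≤ d (chainTerm s ∘ suc)
      ∎
    where
    open ≈ₚ-Reasoning
    lowered : Fin n → ℕ → Poly
    lowered w i = (+ chainsAbove P i w) ·ₚ (x-1 ^ₚ (corank s ∸ 1 ∸ suc i))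

  hInterval-recursion-at : ∀ s → Dec (s ≡ 𝟙) →
                           hInterval s ≈ₚ (δ P s 𝟙 +ₚ sum (λ w → when (s ⊏? w)
                                                                    (chowTerm hInterval s w)))
  hInterval-recursion-at _ (yes refl) = ≈ₚ-sym (begin
    δ P 𝟙 𝟙 +ₚ sum (λ w → when (𝟙 ⊏? w) (chowTerm hInterval 𝟙 w))
      ≈⟨ +ₚ-cong (δ-refl 𝟙) (∑-zero _ (λ w → when-¬ (𝟙 ⊏? w) 𝟙-maximal)) ⟩
    1ₚ +ₚ 0ₚ
      ≈⟨ +ₚ-identityʳ 1ₚ ⟩
    1ₚ
      ≈⟨ hInterval-𝟙 ⟨
    hInterval 𝟙
      ∎)
    where
    open ≈ₚ-Reasoning
    𝟙-maximal : ∀ {w} → ¬ 𝟙 ⊏ w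
    𝟙-maximal {w} (𝟙≤w , 𝟙≢w) = 𝟙≢w (antisym 𝟙≤w (𝟙-max w))
  hInterval-recursion-at s (no s≢𝟙) = ≈ₚ-sym (begin
    δ P s 𝟙 +ₚ sum (λ w → when (s ⊏? w) (chowTerm hInterval s w))
      ≈⟨ +ₚ-cong (δ-≢ s≢𝟙) (∑-when-split-off (s ⊏?_) (interior? s) 𝟙 (chowTerm hInterval s)
                               top-or-interior (𝟙-max s , s≢𝟙) proj₁ (λ (_ , 𝟙≢𝟙) → 𝟙≢𝟙 refl)) ⟩
    0ₚ +ₚ (chowTerm hInterval s 𝟙 +ₚ sum (λ w → when (interior? s w) (chowTerm hInterval s w)))
      ≈⟨ +ₚ-identityˡ _ ⟩
    chowTerm hInterval s 𝟙 +ₚ sum (λ w → when (interior? s w) (chowTerm hInterval s w))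
      ≈⟨ +ₚ-cong top (∑-interior-chowTerm s) ⟩
    (x-1 ^ₚ (corank s ∸ 1)) +ₚ ∑≤ d (chainTerm s ∘ suc)
      ≈⟨ hInterval-unfold s ⟨
    hInterval s
      ∎)
    where
    open ≈ₚ-Reasoning
    top : chowTerm hInterval s 𝟙 ≈ₚ (x-1 ^ₚ (corank s ∸ 1))
    top = ≈ₚ-trans (*ₚ-congʳ (x-1 ^ₚ (corank s ∸ 1)) hInterval-𝟙)
                   (≈ₚ-trans (x-1^-+ (corank s ∸ 1) 0)
                             (≈ₚ-reflexive (cong (x-1 ^ₚ_) (ℕP.+-identityʳ (corank s ∸ 1)))))
    top-or-interior : ∀ {w} → s ⊏ w → w ≡ 𝟙 ⊎ Interior s w
    top-or-interior {w} s⊏w with w ≟ 𝟙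
    ... | yes w≡𝟙 = inj₁ w≡𝟙
    ... | no w≢𝟙  = inj₂ (s⊏w , w≢𝟙)

  hInterval-recursion : ChowRecursion hInterval
  hInterval-recursion s = hInterval-recursion-at s (s ≟ 𝟙)

  sumUpToₚ-≈-∑≤ : ∀ k g → sumUpToₚ P k g ≈ₚ ∑≤ k g
  sumUpToₚ-≈-∑≤ zero    g = ≈ₚ-sym (+ₚ-identityʳ (g 0))
  sumUpToₚ-≈-∑≤ (suc k) g = ≈ₚ-trans (+ₚ-congʳ {g (suc k)} (sumUpToₚ-≈-∑≤ k g)) (≈ₚ-sym (∑≤-last k g))

  hInterval-𝟘 : hInterval 𝟘 ≈ₚ hΔ P
  hInterval-𝟘 = begin
    hInterval 𝟘
      ≈⟨ ∑≤-cong d (λ i → ≈ₚ-reflexive (cong (λ c → (+ fvec P i) ·ₚ (x-1 ^ₚ (c ∸ 1 ∸ i))) corank-𝟘)) ⟩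
    ∑≤ d (λ i → (+ fvec P i) ·ₚ (x-1 ^ₚ (d ∸ i)))
      ≈⟨ sumUpToₚ-≈-∑≤ d _ ⟨
    sumUpToₚ P d (λ i → (+ fvec P i) ·ₚ (x-1 ^ₚ (d ∸ i)))
      ≡⟨ cong (λ e → sumUpToₚ P e (λ i → (+ fvec P i) ·ₚ (x-1 ^ₚ (e ∸ i)))) dΔ≡d ⟨
    sumUpToₚ P (dΔ P) (λ i → (+ fvec P i) ·ₚ (x-1 ^ₚ (dΔ P ∸ i)))
      ≡⟨ hΔ-unfold P ⟨
    hΔ P
      ∎
    where open ≈ₚ-Reasoning

theorem5p4 : (P : GradedBoundedPoset) → Eulerian P →
    (H : Kernel P) → IsEulerianChowFunction P H →
    H (GradedBoundedPoset.𝟘 P) (GradedBoundedPoset.𝟙 P) ≈ₚ hΔ P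
theorem5p4 P _ H (_ , εbar⋆[-H]≈δ) = begin
  H 𝟘 𝟙        ≈⟨ chowRecursion-unique (chowFunction-recursion H εbar⋆[-H]≈δ) hInterval-recursion 𝟘 ⟩
  hInterval 𝟘  ≈⟨ hInterval-𝟘 ⟩
  hΔ P         ∎
  where
  open GradedBoundedPoset P using (𝟘; 𝟙)
  open GradedPosetTheory P
  open ≈ₚ-Reasoning
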